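{- There exists a $(3,2)$-LGDD$(3^8)$.
   Context: A $(3,\lambda)$-GDD of type $g^u$ is a triple $(X,\mathcal{G},\mathcal{B})$ where $X$ is a set of $gu$ points, $\mathcal{G}$ is a partition of $X$ into $u$ groups of size $g$, and $\mathcal{B}$ is a multiset of 3-subsets of $X$ (blocks), each meeting every group in at most one point, such that every 2-subset of $X$ whose two points lie in different groups is contained in exactly $\lambda$ blocks. It is simple if no two blocks are identical. A $(3,\lambda)$-LGDD$(g^u)$ is a collection of $\frac{g(u-2)}{\lambda}$ simple $(3,\lambda)$-GDDs of type $g^u$ on the same point set with the same groups whose block sets are pairwise disjoint. -}

module Defs where

open import Data.Nat using (ℕ; _*_; _∸_; NonZero)
open import Data.Nat.DivMod using (_/_)
open import Data.Fin using (Fin)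
open import Data.Fin.Subset using (Subset; _∈_; ∣_∣)
open import Data.Fin.Subset.Properties using (_∈?_)
open import Data.List using (List; length; filter)
import Data.List.Membership.Propositional as LM
open import Data.List.Relation.Unary.Unique.Propositional using (Unique)
open import Data.Vec using (Vec; count)
open import Data.Product using (_×_; Σ)
open import Relation.Binary.PropositionalEquality using (_≡_; _≢_)
open import Relation.Nullary using (¬_)
open import Relation.Nullary.Decidable using (_×-dec_)

-- Point set X = Fin (g * u).  A block is a subset of X (Subset = Vec Bool).
-- The partition of X into u groups is given by a labelling grp : X → Fin u.

groupSize : ∀ {n u} → (Fin n → Fin u) → Fin u → ℕ
groupSize {n} grp i = length (filter (λ x → Data.Fin._≟_ (grp x) i) (Data.List.allFin n))
  where import Data.Fin ; import Data.List

IsGroupPartition : (g u : ℕ) → (Fin (g * u) → Fin u) → Set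
IsGroupPartition g u grp = ∀ (i : Fin u) → groupSize grp i ≡ g

pairCount : ∀ {n} → Fin n → Fin n → List (Subset n) → ℕ
pairCount x y B = length (filter (λ b → (x ∈? b) ×-dec (y ∈? b)) B)

record Is3GDD (λ' g u : ℕ) (grp : Fin (g * u) → Fin u) (B : List (Subset (g * u))) : Set where
  field
    groups    : IsGroupPartition g u grp
    blockSize : ∀ b → b LM.∈ B → ∣ b ∣ ≡ 3
    transversal : ∀ b → b LM.∈ B → ∀ x y → x ∈ b → y ∈ b → x ≢ y → grp x ≢ grp y
    balanced  : ∀ x y → x ≢ y → grp x ≢ grp y → pairCount x y B ≡ λ'

IsSimple3GDD : (λ' g u : ℕ) (grp : Fin (g * u) → Fin u) (B : List (Subset (g * u))) → Set
IsSimple3GDD λ' g u grp B = Is3GDD λ' g u grp B × Unique B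

Is3LGDD : (λ' g u : ℕ) .{{_ : NonZero λ'}} (grp : Fin (g * u) → Fin u)
          → (Fin ((g * (u ∸ 2)) / λ') → List (Subset (g * u))) → Set
Is3LGDD λ' g u grp F =
  (∀ i → IsSimple3GDD λ' g u grp (F i)) ×
  (∀ i j → i ≢ j → ∀ b → b LM.∈ F i → ¬ (b LM.∈ F j))

Exists3LGDD : (λ' g u : ℕ) .{{_ : NonZero λ'}} → Set
Exists3LGDD λ' g u =
  Σ (Fin (g * u) → Fin u) λ grp →
  Σ (Fin ((g * (u ∸ 2)) / λ') → List (Subset (g * u))) λ F → Is3LGDD λ' g u grp F

-- Take the points to be ℤ₂₁ ∪ {∞₀, ∞₁, ∞₂}, the groups being the cosets of {0, 7, 14} together with
-- {∞₀, ∞₁, ∞₂}, and let ℤ₂₁ act on the ∞ᵣ through ℤ₂₁ → ℤ₃. Each of the nine GDDs is the development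
-- of eight base blocks, hence a union of orbits of transversal triples; since the 72 base blocks lie
-- in distinct orbits, the nine block sets are disjoint (between them they use each of the 1512
-- transversal triples exactly once). The remaining GDD axioms are finite checks, done by evaluating
-- decision procedures for them.

module Submission where

open import Data.Bool using (if_then_else_) renaming (_≟_ to _≟ᵇ_)
open import Data.Bool.ListAction using (any)
open import Data.Fin using (Fin; toℕ; quotient)
open import Data.Fin.Patterns
import Data.Fin.Properties as Fin
open import Data.Fin.Subset using (Subset; _∈_; ∣_∣)
open import Data.Fin.Subset.Properties using (_∈?_)
open import Data.List using (List; []; _∷_; map; concatMap; filter; foldr; allFin; upTo; cartesianProduct; findIndex; lookup)
import Data.List.Membership.Propositional as LM
open import Data.List.Membership.Propositional.Properties using (∈-filter⁺; ∈-filter⁻; ∈-allFin)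
open import Data.List.Relation.Unary.All as All using (All)
import Data.List.Relation.Unary.Unique.DecPropositional as UniqueDec
open import Data.Maybe using (Maybe; just)
import Data.Maybe.Properties as Maybe
open import Data.Nat using (ℕ; _+_; _*_; _^_; _<ᵇ_; _≡ᵇ_; _⊓′_; _/_; _%_)
open import Data.Nat.ListAction using (sum)
open import Data.Nat.Properties using (_≟_)
open import Data.Product using (_×_; _,_; proj₂)
open import Data.Vec using (tabulate)
open import Data.Vec.Properties using (≡-dec)
open import Function.Definitions using (Injective)
open import Relation.Binary.PropositionalEquality using (_≡_; _≢_; sym; trans)
open import Relation.Nullary using (¬_; Dec; ¬?)
open import Relation.Nullary.Decidable using (map′; from-yes; _×-dec_; _→-dec_)
open import Relation.Unary using (Decidable)
open import Defs

open import Data.List.Membership.DecPropositional _≟_ using () renaming (_∈?_ to _∈ℕ?_)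

∀-∈? : {A : Set} {P : A → Set} → Decidable P → (xs : List A) → Dec (∀ x → x LM.∈ xs → P x)
∀-∈? P? xs = map′ (λ ps x → All.lookup ps) (λ ps → All.tabulate (ps _)) (All.all? P? xs)

isGroupPartition? : ∀ g u grp → Dec (IsGroupPartition g u grp)
isGroupPartition? g u grp = Fin.all? λ i → groupSize grp i ≟ g

members : ∀ {n} → Subset n → List (Fin n)
members {n} b = filter (_∈? b) (allFin n)

∈-members⁺ : ∀ {n} {x : Fin n} {b} → x ∈ b → x LM.∈ members b
∈-members⁺ {x = x} {b} = ∈-filter⁺ (_∈? b) (∈-allFin x)

∈-members⁻ : ∀ {n} {x : Fin n} {b} → x LM.∈ members b → x ∈ b
∈-members⁻ {n} {b = b} x∈ = proj₂ (∈-filter⁻ (_∈? b) {xs = allFin n} x∈)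

module _ {n u : ℕ} (grp : Fin n → Fin u) where

  transversal? : (b : Subset n) → Dec (∀ x y → x ∈ b → y ∈ b → x ≢ y → grp x ≢ grp y)
  transversal? b =
    map′ (λ t x y x∈b y∈b → t x (∈-members⁺ x∈b) y (∈-members⁺ y∈b))
         (λ t x x∈b y y∈b → t x y (∈-members⁻ x∈b) (∈-members⁻ y∈b))
         (∀-∈? (λ x → ∀-∈? (λ y → ¬? (x Fin.≟ y) →-dec ¬? (grp x Fin.≟ grp y)) (members b)) (members b))

  balanced? : (λ' : ℕ) (B : List (Subset n)) →
              Dec (∀ x y → x ≢ y → grp x ≢ grp y → pairCount x y B ≡ λ')
  balanced? λ' B = Fin.all? λ x → Fin.all? λ y →
    ¬? (x Fin.≟ y) →-dec ¬? (grp x Fin.≟ grp y) →-dec pairCount x y B ≟ λ'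

is3GDD? : ∀ λ' g u grp B → Dec (Is3GDD λ' g u grp B)
is3GDD? λ' g u grp B =
  map′ (λ (p , q , r , s) → record { groups = p ; blockSize = q ; transversal = r ; balanced = s })
       (λ G → let open Is3GDD G in groups , blockSize , transversal , balanced)
       (isGroupPartition? g u grp ×-dec ∀-∈? (λ b → ∣ b ∣ ≟ 3) B ×-dec
        ∀-∈? (transversal? grp) B ×-dec balanced? grp λ' B)

isSimple3GDD? : ∀ λ' g u grp B → Dec (IsSimple3GDD λ' g u grp B)
isSimple3GDD? λ' g u grp B = is3GDD? λ' g u grp B ×-dec unique? B
  where open UniqueDec (≡-dec {n = g * u} _≟ᵇ_) using (unique?)

coloured⇒disjoint : {I A C : Set} (F : I → List A) (colour : A → C) (ι : I → C) →
  Injective _≡_ _≡_ ι → (∀ i → All (λ a → colour a ≡ ι i) (F i)) →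
  ∀ i j → i ≢ j → ∀ a → a LM.∈ F i → ¬ a LM.∈ F j
coloured⇒disjoint F colour ι ι-injective coloured i j i≢j a a∈Fi a∈Fj =
  i≢j (ι-injective (trans (sym (All.lookup (coloured i) a∈Fi)) (All.lookup (coloured j) a∈Fj)))

-- Point 3a + r with a < 7 stands for (a , r) ∈ ℤ₇ × ℤ₃ ≅ ℤ₂₁ and 21 + r for ∞ᵣ; the groups are
-- {3a, 3a+1, 3a+2}, so the group labelling is quotient 3.
act : ℕ × ℕ → ℕ → ℕ
act (i , j) x = if x <ᵇ 21 then 3 * ((x / 3 + i) % 7) + (x % 3 + j) % 3 else 21 + (x % 3 + j) % 3

ℤ₇×ℤ₃ : List (ℕ × ℕ)
ℤ₇×ℤ₃ = cartesianProduct (upTo 7) (upTo 3)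

develop : List ℕ → List (List ℕ)
develop B = map (λ g → map (act g) B) ℤ₇×ℤ₃

block : List ℕ → Subset 24
block xs = tabulate λ p → any (toℕ p ≡ᵇ_) xs

points : ∀ {n} → Subset n → List ℕ
points b = map toℕ (members b)

key : List ℕ → ℕ
key xs = sum (map (2 ^_) xs)

-- _⊓′_ compares with the builtin _<ᵇ_, whereas _⊓_ would recurse in unary on keys up to 2²⁴.
orbitKey : List ℕ → ℕ
orbitKey xs = foldr (λ g m → key (map (act g) xs) ⊓′ m) (key xs) ℤ₇×ℤ₃

⟨_,_,_⟩ : ℕ → ℕ → ℕ → List ℕ
⟨ x , y , z ⟩ = x ∷ y ∷ z ∷ []

-- Each base block has the least key in its orbit, which is how colour recognises the orbit.
baseBlocks : List (List (List ℕ))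
baseBlocks =
    (⟨ 0 , 3 , 6 ⟩ ∷ ⟨ 0 , 4 , 6 ⟩ ∷ ⟨ 0 , 4 , 9 ⟩ ∷ ⟨ 0 , 5 , 12 ⟩
     ∷ ⟨ 1 , 8 , 12 ⟩ ∷ ⟨ 0 , 8 , 21 ⟩ ∷ ⟨ 1 , 9 , 21 ⟩ ∷ ⟨ 2 , 10 , 21 ⟩ ∷ [])
  ∷ (⟨ 1 , 4 , 6 ⟩ ∷ ⟨ 2 , 5 , 6 ⟩ ∷ ⟨ 1 , 3 , 9 ⟩ ∷ ⟨ 2 , 3 , 9 ⟩
     ∷ ⟨ 0 , 7 , 12 ⟩ ∷ ⟨ 2 , 9 , 21 ⟩ ∷ ⟨ 1 , 10 , 21 ⟩ ∷ ⟨ 0 , 11 , 21 ⟩ ∷ [])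
  ∷ (⟨ 1 , 5 , 6 ⟩ ∷ ⟨ 0 , 3 , 9 ⟩ ∷ ⟨ 0 , 5 , 9 ⟩ ∷ ⟨ 2 , 5 , 9 ⟩
     ∷ ⟨ 2 , 4 , 12 ⟩ ∷ ⟨ 0 , 6 , 21 ⟩ ∷ ⟨ 2 , 7 , 21 ⟩ ∷ ⟨ 1 , 11 , 21 ⟩ ∷ [])
  ∷ (⟨ 2 , 4 , 6 ⟩ ∷ ⟨ 1 , 4 , 9 ⟩ ∷ ⟨ 1 , 5 , 9 ⟩ ∷ ⟨ 2 , 8 , 9 ⟩
     ∷ ⟨ 0 , 3 , 12 ⟩ ∷ ⟨ 1 , 6 , 21 ⟩ ∷ ⟨ 2 , 8 , 21 ⟩ ∷ ⟨ 0 , 10 , 21 ⟩ ∷ [])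
  ∷ (⟨ 0 , 5 , 6 ⟩ ∷ ⟨ 0 , 8 , 9 ⟩ ∷ ⟨ 1 , 4 , 12 ⟩ ∷ ⟨ 2 , 5 , 12 ⟩
     ∷ ⟨ 0 , 8 , 12 ⟩ ∷ ⟨ 0 , 5 , 21 ⟩ ∷ ⟨ 2 , 6 , 21 ⟩ ∷ ⟨ 1 , 7 , 21 ⟩ ∷ [])
  ∷ (⟨ 0 , 6 , 9 ⟩ ∷ ⟨ 0 , 7 , 9 ⟩ ∷ ⟨ 1 , 5 , 12 ⟩ ∷ ⟨ 2 , 7 , 12 ⟩
     ∷ ⟨ 2 , 8 , 12 ⟩ ∷ ⟨ 0 , 3 , 21 ⟩ ∷ ⟨ 2 , 4 , 21 ⟩ ∷ ⟨ 1 , 5 , 21 ⟩ ∷ [])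
  ∷ (⟨ 2 , 4 , 9 ⟩ ∷ ⟨ 1 , 6 , 9 ⟩ ∷ ⟨ 2 , 6 , 9 ⟩ ∷ ⟨ 0 , 4 , 12 ⟩
     ∷ ⟨ 0 , 6 , 12 ⟩ ∷ ⟨ 1 , 3 , 21 ⟩ ∷ ⟨ 2 , 3 , 21 ⟩ ∷ ⟨ 1 , 8 , 21 ⟩ ∷ [])
  ∷ (⟨ 1 , 3 , 6 ⟩ ∷ ⟨ 1 , 3 , 12 ⟩ ∷ ⟨ 2 , 3 , 12 ⟩ ∷ ⟨ 2 , 6 , 12 ⟩
     ∷ ⟨ 1 , 7 , 12 ⟩ ∷ ⟨ 0 , 4 , 21 ⟩ ∷ ⟨ 2 , 5 , 21 ⟩ ∷ ⟨ 0 , 7 , 21 ⟩ ∷ [])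
  ∷ (⟨ 2 , 3 , 6 ⟩ ∷ ⟨ 1 , 7 , 9 ⟩ ∷ ⟨ 2 , 7 , 9 ⟩ ∷ ⟨ 1 , 8 , 9 ⟩
     ∷ ⟨ 1 , 6 , 12 ⟩ ∷ ⟨ 1 , 4 , 21 ⟩ ∷ ⟨ 0 , 9 , 21 ⟩ ∷ ⟨ 2 , 11 , 21 ⟩ ∷ [])
  ∷ []

blocks : Fin 9 → List (Subset 24)
blocks i = map block (concatMap develop (lookup baseBlocks i))

classOfOrbitKey : ℕ → Maybe (Fin 9)
classOfOrbitKey k = findIndex (λ Bs → k ∈ℕ? map key Bs) baseBlocks

colour : Subset 24 → Maybe (Fin 9)
colour b = classOfOrbitKey (orbitKey (points b))

-- Deciding the classes one at a time keeps the memory used by each evaluation small.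
blocks-simple : ∀ i → IsSimple3GDD 2 3 8 (quotient 3) (blocks i)
blocks-simple 0F = from-yes (isSimple3GDD? 2 3 8 (quotient 3) (blocks 0F))
blocks-simple 1F = from-yes (isSimple3GDD? 2 3 8 (quotient 3) (blocks 1F))
blocks-simple 2F = from-yes (isSimple3GDD? 2 3 8 (quotient 3) (blocks 2F))
blocks-simple 3F = from-yes (isSimple3GDD? 2 3 8 (quotient 3) (blocks 3F))
blocks-simple 4F = from-yes (isSimple3GDD? 2 3 8 (quotient 3) (blocks 4F))
blocks-simple 5F = from-yes (isSimple3GDD? 2 3 8 (quotient 3) (blocks 5F))
blocks-simple 6F = from-yes (isSimple3GDD? 2 3 8 (quotient 3) (blocks 6F))
blocks-simple 7F = from-yes (isSimple3GDD? 2 3 8 (quotient 3) (blocks 7F))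
blocks-simple 8F = from-yes (isSimple3GDD? 2 3 8 (quotient 3) (blocks 8F))

blocks-coloured : ∀ i → All (λ b → colour b ≡ just i) (blocks i)
blocks-coloured = from-yes (Fin.all? λ i → All.all? (λ b → Maybe.≡-dec Fin._≟_ (colour b) (just i)) (blocks i))

lemma4p1 : Exists3LGDD 2 3 8
lemma4p1 = quotient 3 , blocks , blocks-simple , coloured⇒disjoint blocks colour just Maybe.just-injective blocks-coloured
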